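{- Let $A$ be an array, let $a,b$ be non-negative integers and let $W,W'$ be different $(a,b)$-arrays. If occurrences of $W^{3,3}$ and $(W')^{3,3}$ in $A$ share the same corner (i.e., both have the same top-left corner, or the same top-right, or the same bottom-left, or the same bottom-right corner), then at least one of $W$, $W'$ is not primitive.
   Context: For an array $W$ and positive integers $\alpha,\beta$, $W^{\alpha,\beta}$ denotes the array composed of $\alpha\times\beta$ copies of $W$ ($\alpha$ copies vertically, $\beta$ horizontally). An array $B$ is primitive if $B=C^{\alpha,\beta}$ for some array $C$ and positive integers $\alpha,\beta$ implies $\alpha=\beta=1$. An $(a,b)$-array is an array $W$ with $\mathsf{height}(W)\in[2^a,2^{a+1})$ and $\mathsf{width}(W)\in[2^b,2^{b+1})$. An occurrence of an array in $A$ is a subarray of $A$ equal to it. -}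

module Defs where

open import Data.Nat using (ℕ; _+_; _*_; _^_; _≤_; _<_)
open import Data.Product using (Σ; _×_)
open import Data.Sum using (_⊎_)
open import Relation.Binary.PropositionalEquality using (_≡_)

-- A 2D array over an alphabet S: a height, a width, and entries
-- at i j for 0 ≤ i < height, 0 ≤ j < width (values outside are irrelevant).
record Array (S : Set) : Set where
  constructor mkArray
  field
    height : ℕ
    width  : ℕ
    at     : ℕ → ℕ → S
open Array public

_≈A_ : {S : Set} → Array S → Array S → Set
B ≈A C = (height B ≡ height C) × (width B ≡ width C) ×
         (∀ i j → i < height B → j < width B → at B i j ≡ at C i j)

IsPower : {S : Set} → Array S → Array S → ℕ → ℕ → Set
IsPower B C α β =
  (height B ≡ α * height C) × (width B ≡ β * width C) ×
  (∀ p q i j → p < α → q < β → i < height C → j < width C →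
     at B (p * height C + i) (q * width C + j) ≡ at C i j)

Primitive : {S : Set} → Array S → Set
Primitive B = ∀ C α β → 1 ≤ α → 1 ≤ β → IsPower B C α β → (α ≡ 1) × (β ≡ 1)

IsABArray : {S : Set} → ℕ → ℕ → Array S → Set
IsABArray a b W =
  (2 ^ a ≤ height W) × (height W < 2 ^ (a + 1)) ×
  (2 ^ b ≤ width W)  × (width W  < 2 ^ (b + 1))

OccursAt : {S : Set} → Array S → Array S → ℕ → ℕ → Set
OccursAt A V r c =
  (r + height V ≤ height A) × (c + width V ≤ width A) ×
  (∀ i j → i < height V → j < width V → at A (r + i) (c + j) ≡ at V i j)

OccursCubeAt : {S : Set} → Array S → Array S → ℕ → ℕ → Set
OccursCubeAt A W r c = Σ (Array _) (λ P → IsPower P W 3 3 × OccursAt A P r c)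

-- W^{3,3} has height 3 * height W and width 3 * width W.
ShareCorner : {S : Set} → Array S → Array S → ℕ → ℕ → ℕ → ℕ → Set
ShareCorner W W' r c r' c' =
  ((r ≡ r') × (c ≡ c')) ⊎
  ((r ≡ r') × (c + 3 * width W ≡ c' + 3 * width W')) ⊎
  ((r + 3 * height W ≡ r' + 3 * height W') × (c ≡ c')) ⊎
  ((r + 3 * height W ≡ r' + 3 * height W') × (c + 3 * width W ≡ c' + 3 * width W'))

module Submission where

-- Suppose W^{3,3} occurs at (r , c) and W'^{3,3} at (r' , c') with a shared corner, and W
-- is primitive.  Heights (and widths) of (a,b)-arrays are within a factor two of each other.
-- Take a block row of W^{3,3} on the side of the shared corner: each of its rows of A also
-- lies in W'^{3,3}, and on a window of w + w' columns lying in both cubes it has periods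
-- w and w'.  By the (weak) Fine–Wilf theorem it has period gcd w w', and since the window
-- contains a whole block of W, every row of W has period gcd w w'.  Transposing, every
-- column of W has period gcd h h'.  A primitive array with such periods must coincide with
-- its top-left gcd-block, so h = gcd h h' and w = gcd w w', i.e. h ∣ h' and w ∣ w'.
-- Exchanging W and W' gives equality of dimensions, hence the cubes have the same top-left
-- corner, hence W = W'.

open import Defs
open import Data.Nat using (ℕ)
open import Data.Product using (_×_)
open import Relation.Nullary using (¬_)

open import Data.Nat.Base
  using (zero; suc; _+_; _*_; _^_; _≤_; _<_; z≤n; s≤s; NonZero; >-nonZero; _%_; _/_)
open import Data.Nat.Properties
open import Data.Nat.DivMod using (m≡m%n+[m/n]*n; [m+n]%n≡m%n; m%n<n; m<n*o⇒m/o<n)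
open import Data.Nat.Divisibility using (_∣_; divides; ∣-refl; _∣0; ∣m∣n⇒∣m+n; ∣-antisym)
open import Data.Nat.GCD using (gcd; gcd[m,n]∣m; gcd[m,n]∣n; gcd-greatest)
open import Data.Nat.Tactic.RingSolver using (solve-∀)
open import Data.Product using (∃-syntax; _,_; proj₁; proj₂)
open import Data.Sum using (inj₁; inj₂)
open import Data.Empty using (⊥-elim)
open import Function using (flip)
open import Relation.Binary.PropositionalEquality
open import Relation.Nullary using (yes; no)

Periodic : {S : Set} → (ℕ → S) → ℕ → ℕ → Set
Periodic u n p = ∀ j → j + p < n → u j ≡ u (j + p)

periodic-iterate : ∀ {S} {u : ℕ → S} {n d} → Periodic u n d →
  ∀ k j → j + k * d < n → u j ≡ u (j + k * d)
periodic-iterate {u = u} P zero j _ = cong u (sym (+-identityʳ j))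
periodic-iterate {u = u} {n} {d} P (suc k) j lt =
  trans (periodic-iterate P k j (≤-<-trans (m≤m+n _ d) lt'))
        (trans (P (j + k * d) lt') (cong u reassoc))
  where
  reassoc : j + k * d + d ≡ j + suc k * d
  reassoc = trans (+-assoc j (k * d) d) (cong (j +_) (+-comm (k * d) d))
  lt' : j + k * d + d < n
  lt' = subst (_< n) (sym reassoc) lt

periodic-multiple : ∀ {S} {u : ℕ → S} {n d} k → Periodic u n d → Periodic u n (k * d)
periodic-multiple k P j = periodic-iterate P k j

-- One Euclid step: if p and p + e are periods and 2p + e ≤ n, then e is a period.
-- Near the left end go right by p + e and back by p; near the right end go back by p
-- and right by p + e.
periodic-difference : ∀ {S} {u : ℕ → S} {n} p e → Periodic u n p → Periodic u n (p + e) →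
  p + (p + e) ≤ n → Periodic u n e
periodic-difference {u = u} {n} p e Pp Pq bound j j+e<n with j + (p + e) <? n
... | yes fits =
  trans (Pq j fits) (sym (trans (Pp (j + e) (subst (_< n) (sym swap) fits)) (cong u swap)))
  where
  swap : j + e + p ≡ j + (p + e)
  swap = trans (+-assoc j e p) (cong (j +_) (+-comm e p))
... | no overflow with m≤n⇒∃[o]m+o≡n p≤j
  where
  p≤j : p ≤ j
  p≤j = +-cancelʳ-≤ (p + e) p j (≤-trans bound (≮⇒≥ overflow))
... | t , refl =
  trans (cong u (+-comm p t))
   (trans (sym (Pp t (≤-<-trans (m≤m+n (t + p) e) t+p+e<n)))
    (trans (Pq t (subst (_< n) (+-assoc t p e) t+p+e<n)) (cong u regroup)))
  where
  regroup : t + (p + e) ≡ p + t + e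
  regroup = trans (sym (+-assoc t p e)) (cong (_+ e) (+-comm t p))
  t+p+e<n : t + p + e < n
  t+p+e<n = subst (λ x → x + e < n) (+-comm p t) j+e<n

-- Euclid's algorithm on periods (fuel bounds p + q): two periods with p + q ≤ n
-- admit a common period dividing both.
mutual
  common-period : ∀ {S} {u : ℕ → S} {n} fuel p q → p + q ≤ fuel → p + q ≤ n →
    Periodic u n p → Periodic u n q → ∃[ d ] (d ∣ p × d ∣ q × Periodic u n d)
  common-period {n = n} fuel p q p+q≤fuel p+q≤n Pp Pq with ≤-total p q
  ... | inj₁ p≤q = ordered-common-period fuel p q p≤q p+q≤fuel p+q≤n Pp Pq
  ... | inj₂ q≤p with ordered-common-period fuel q p q≤p
                        (subst (_≤ fuel) (+-comm p q) p+q≤fuel)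
                        (subst (_≤ n) (+-comm p q) p+q≤n) Pq Pp
  ...   | d , d∣q , d∣p , Pd = d , d∣p , d∣q , Pd

  -- For p ≤ q write q = p + e: then e is a period, and (p , e) is a smaller instance.
  ordered-common-period : ∀ {S} {u : ℕ → S} {n} fuel p q → p ≤ q → p + q ≤ fuel → p + q ≤ n →
    Periodic u n p → Periodic u n q → ∃[ d ] (d ∣ p × d ∣ q × Periodic u n d)
  ordered-common-period _ zero q _ _ _ _ Pq = q , q ∣0 , ∣-refl , Pq
  ordered-common-period zero (suc _) _ _ () _ _ _
  ordered-common-period (suc fuel) (suc p') q p≤q p+q≤fuel p+q≤n Pp Pq with m≤n⇒∃[o]m+o≡n p≤q
  ... | e , refl with common-period fuel (suc p') e
                        (≤-trans (m≤n+m (suc (p' + e)) p') (≤-pred p+q≤fuel))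
                        (≤-trans (m≤n+m (suc p' + e) (suc p')) p+q≤n)
                        Pp (periodic-difference (suc p') e Pp Pq p+q≤n)
  ...   | d , d∣p , d∣e , Pd = d , d∣p , ∣m∣n⇒∣m+n d∣p d∣e , Pd

fine-wilf : ∀ {S} {u : ℕ → S} {n p q} → Periodic u n p → Periodic u n q → p + q ≤ n →
  Periodic u n (gcd p q)
fine-wilf {u = u} {n} {p} {q} Pp Pq le with common-period (p + q) p q ≤-refl le Pp Pq
... | d , d∣p , d∣q , Pd with gcd-greatest d∣p d∣q
...   | divides k g≡kd = subst (Periodic u n) (sym g≡kd) (periodic-multiple k Pd)

periodic-window : ∀ {S} {u v : ℕ → S} {n m p} o → Periodic u n p →
  (∀ t → t < m → v t ≡ u (o + t)) → o + m ≤ n → Periodic v m p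
periodic-window {u = u} {v} {n} {m} {p} o P agree fits t t+p<m =
  trans (agree t (≤-<-trans (m≤m+n t p) t+p<m))
   (trans (subst (λ x → u (o + t) ≡ u x) (+-assoc o t p) (P (o + t) inside))
          (sym (agree (t + p) t+p<m)))
  where
  inside : o + t + p < n
  inside = subst (_< n) (sym (+-assoc o t p)) (<-≤-trans (+-monoʳ-< o t+p<m) fits)

block-bound : ∀ {p k i h} → p < k → i < h → p * h + i < k * h
block-bound {p} {k} {i} {h} p<k i<h =
  <-≤-trans (+-monoʳ-< (p * h) i<h) (subst (_≤ k * h) (+-comm h (p * h)) (*-monoˡ-≤ h p<k))

block-decomposition : ∀ x n .{{_ : NonZero n}} → x < 3 * n → x / n < 3 × x / n * n + x % n ≡ x
block-decomposition x n x<3n =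
  m<n*o⇒m/o<n x<3n , trans (+-comm (x / n * n) (x % n)) (sym (m≡m%n+[m/n]*n x n))

record Cube {S : Set} (F V : ℕ → ℕ → S) (h w r c : ℕ) : Set where
  constructor cube
  field
    block-cell : ∀ p q i j → p < 3 → q < 3 → i < h → j < w →
      F (r + (p * h + i)) (c + (q * w + j)) ≡ V i j
open Cube

occurrence-cube : ∀ {S} {A W : Array S} {r c} → OccursCubeAt A W r c →
  Cube (at A) (at W) (height W) (width W) r c
occurrence-cube {W = W} (_ , (hP , wP , power) , (_ , _ , occurs)) =
  cube λ p q i j p<3 q<3 i<h j<w →
  trans (occurs (p * height W + i) (q * width W + j)
          (subst (p * height W + i <_) (sym hP) (block-bound p<3 i<h))
          (subst (q * width W + j <_) (sym wP) (block-bound q<3 j<w)))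
        (power p q i j p<3 q<3 i<h j<w)

cube-transpose : ∀ {S} {F V : ℕ → ℕ → S} {h w r c} → Cube F V h w r c →
  Cube (flip F) (flip V) w h c r
cube-transpose K = cube λ q p j i q<3 p<3 j<w i<h → block-cell K p q i j p<3 q<3 i<h j<w

cube-origin : ∀ {S} {F V : ℕ → ℕ → S} {h w r c} → Cube F V h w r c →
  ∀ i j → i < h → j < w → F (r + i) (c + j) ≡ V i j
cube-origin K i j = block-cell K 0 0 i j (s≤s z≤n) (s≤s z≤n)

cube-cell : ∀ {S} {F V : ℕ → ℕ → S} {h w r c} .{{_ : NonZero h}} .{{_ : NonZero w}} →
  Cube F V h w r c → ∀ i j → i < 3 * h → j < 3 * w → F (r + i) (c + j) ≡ V (i % h) (j % w)
cube-cell {F = F} {h = h} {w} {r} {c} K i j i<3h j<3w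
  with block-decomposition i h i<3h | block-decomposition j w j<3w
... | p<3 , i≡ | q<3 , j≡ =
  trans (cong₂ (λ x y → F (r + x) (c + y)) (sym i≡) (sym j≡))
        (block-cell K (i / h) (j / w) (i % h) (j % w) p<3 q<3 (m%n<n i h) (m%n<n j w))

cube-row-periodic : ∀ {S} {F V : ℕ → ℕ → S} {h w r c} .{{_ : NonZero h}} .{{_ : NonZero w}} →
  Cube F V h w r c → ∀ i → i < 3 * h → Periodic (λ t → F (r + i) (c + t)) (3 * w) w
cube-row-periodic {V = V} {h} {w} K i i<3h t t+w<3w =
  trans (cube-cell K i t i<3h (≤-<-trans (m≤m+n t w) t+w<3w))
   (trans (cong (V (i % h)) (sym ([m+n]%n≡m%n t w)))
          (sym (cube-cell K i (t + w) i<3h t+w<3w)))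

Balanced : ℕ → ℕ → Set
Balanced x y = x ≤ 2 * y × y ≤ 2 * x

data Aligned (x h x' h' : ℕ) : Set where
  same-first : x ≡ x' → Aligned x h x' h'
  same-last  : x + 3 * h ≡ x' + 3 * h' → Aligned x h x' h'

aligned-sym : ∀ {x h x' h'} → Aligned x h x' h' → Aligned x' h' x h
aligned-sym (same-first eq) = same-first (sym eq)
aligned-sym (same-last eq) = same-last (sym eq)

aligned-equal : ∀ {x h x' h'} → Aligned x h x' h' → h ≡ h' → x ≡ x'
aligned-equal (same-first eq) _ = eq
aligned-equal {h = h} (same-last eq) refl = +-cancelʳ-≡ (3 * h) _ _ eq

corner-alignment : ∀ {S} (W W' : Array S) {r c r' c'} → ShareCorner W W' r c r' c' →
  Aligned r (height W) r' (height W') × Aligned c (width W) c' (width W')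
corner-alignment _ _ (inj₁ (rows , cols)) = same-first rows , same-first cols
corner-alignment _ _ (inj₂ (inj₁ (rows , cols))) = same-first rows , same-last cols
corner-alignment _ _ (inj₂ (inj₂ (inj₁ (rows , cols)))) = same-last rows , same-first cols
corner-alignment _ _ (inj₂ (inj₂ (inj₂ (rows , cols)))) = same-last rows , same-last cols

-- Along one axis, a cube at c with blocks of size w and a cube at c' with blocks of size
-- w' share a window of length w + w' starting at c + a = c' + a', and block q of the
-- first cube lies in that window at offset o.
record Overlap (c w c' w' : ℕ) : Set where
  field
    q a a' o : ℕ
    q<3 : q < 3
    same-start : c + a ≡ c' + a'
    fits : a + (w + w') ≤ 3 * w
    fits' : a' + (w + w') ≤ 3 * w'
    block-start : q * w ≡ a + o
    block-fits : o + w ≤ w + w'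

  window-shift : ∀ t → c + (a + t) ≡ c' + (a' + t)
  window-shift t = trans (sym (+-assoc c a t)) (trans (cong (_+ t) same-start) (+-assoc c' a' t))

  block-offset : ∀ x → q * w + x ≡ a + (o + x)
  block-offset x = trans (cong (_+ x) block-start) (+-assoc a o x)

  block-inside : ∀ {x} → x < w → a' + (o + x) < 3 * w'
  block-inside x<w = <-≤-trans (+-monoʳ-< a' (<-≤-trans (+-monoʳ-< o x<w) block-fits)) fits'

rotate : ∀ x y z → x + (y + z) ≡ y + (z + x)
rotate = solve-∀

-- Balanced aligned cubes overlap: take the window at the shared end, and the first or
-- last block of the first cube.
aligned-overlap : ∀ {c w c' w'} → Balanced w w' → Aligned c w c' w' → Overlap c w c' w'
aligned-overlap {c} {w} {.c} {w'} (w≤2w' , w'≤2w) (same-first refl) = record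
  { q = 0 ; a = 0 ; a' = 0 ; o = 0 ; q<3 = s≤s z≤n ; same-start = refl
  ; fits = +-monoʳ-≤ w w'≤2w
  ; fits' = subst (_≤ 3 * w') (+-comm w' w) (+-monoʳ-≤ w' w≤2w')
  ; block-start = refl ; block-fits = m≤m+n w w' }
aligned-overlap {c} {w} {c'} {w'} (w≤2w' , w'≤2w) (same-last ends)
  with m≤n⇒∃[o]m+o≡n w'≤2w | m≤n⇒∃[o]m+o≡n w≤2w'
... | e , w'+e≡2w | e' , w+e'≡2w' = record
  { q = 2 ; a = e ; a' = e' ; o = w' ; q<3 = s≤s (s≤s (s≤s z≤n))
  ; same-start = +-cancelʳ-≡ (w + w') _ _ same-end
  ; fits = ≤-reflexive span ; fits' = ≤-reflexive span'
  ; block-start = trans (sym w'+e≡2w) (+-comm w' e) ; block-fits = ≤-reflexive (+-comm w' w) }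
  where
  span : e + (w + w') ≡ 3 * w
  span = trans (rotate e w w') (cong (w +_) w'+e≡2w)
  span' : e' + (w + w') ≡ 3 * w'
  span' = trans (cong (e' +_) (+-comm w w')) (trans (rotate e' w' w) (cong (w' +_) w+e'≡2w'))
  open ≡-Reasoning
  same-end : c + e + (w + w') ≡ c' + e' + (w + w')
  same-end = begin
    c + e + (w + w')    ≡⟨ +-assoc c e (w + w') ⟩
    c + (e + (w + w'))  ≡⟨ cong (c +_) span ⟩
    c + 3 * w           ≡⟨ ends ⟩
    c' + 3 * w'         ≡⟨ cong (c' +_) span' ⟨
    c' + (e' + (w + w')) ≡⟨ +-assoc c' e' (w + w') ⟨
    c' + e' + (w + w')  ∎

-- If V and V' have overlapping cubes in F, every row of V has period gcd w w':
-- the row of F through row i of the overlapping block row of V's cube is, on the common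
-- column window of length w + w', both w- and w'-periodic, and that window contains a
-- whole copy of row i of V.
rows-periodic : ∀ {S} {F V V' : ℕ → ℕ → S} {h w h' w' r c r' c'}
  .{{_ : NonZero h}} .{{_ : NonZero w}} .{{_ : NonZero h'}} .{{_ : NonZero w'}} →
  Cube F V h w r c → Cube F V' h' w' r' c' → Overlap r h r' h' → Overlap c w c' w' →
  ∀ i → i < h → Periodic (V i) w (gcd w w')
rows-periodic {F = F} {V} {h = h} {w} {w' = w'} {r} {c} {r'} K K' R C i i<h =
  periodic-window C.o (fine-wilf window-w window-w' ≤-refl) row-in-window C.block-fits
  where
  module R = Overlap R
  module C = Overlap C
  y : ℕ
  y = r + (R.q * h + i)
  window : ℕ → _
  window t = F y (c + (C.a + t))
  window-w : Periodic window (w + w') w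
  window-w = periodic-window C.a (cube-row-periodic K (R.q * h + i) (block-bound R.q<3 i<h))
                (λ t _ → refl) C.fits
  y-in-K' : y ≡ r' + (R.a' + (R.o + i))
  y-in-K' = trans (cong (r +_) (R.block-offset i)) (R.window-shift (R.o + i))
  window-w' : Periodic window (w + w') w'
  window-w' = periodic-window C.a' (cube-row-periodic K' (R.a' + (R.o + i)) (R.block-inside i<h))
                (λ t _ → cong₂ F y-in-K' (C.window-shift t)) C.fits'
  row-in-window : ∀ j → j < w → V i j ≡ window (C.o + j)
  row-in-window j j<w =
    trans (sym (block-cell K R.q C.q i j R.q<3 C.q<3 i<h j<w))
          (cong (λ x → F y (c + x)) (C.block-offset j))

columns-periodic : ∀ {S} {F V V' : ℕ → ℕ → S} {h w h' w' r c r' c'}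
  .{{_ : NonZero h}} .{{_ : NonZero w}} .{{_ : NonZero h'}} .{{_ : NonZero w'}} →
  Cube F V h w r c → Cube F V' h' w' r' c' → Overlap r h r' h' → Overlap c w c' w' →
  ∀ j → j < w → Periodic (λ i → V i j) h (gcd h h')
columns-periodic K K' R C = rows-periodic (cube-transpose K) (cube-transpose K') C R

periodic-power : ∀ {S} (W : Array S) {gv gw α β} →
  (∀ i → i < height W → Periodic (at W i) (width W) gw) →
  (∀ j → j < width W → Periodic (λ i → at W i j) (height W) gv) →
  height W ≡ α * gv → width W ≡ β * gw → IsPower W (mkArray gv gw (at W)) α β
periodic-power W {gv} {gw} {α} {β} rows cols h≡ w≡ = h≡ , w≡ , tile
  where
  open ≡-Reasoning
  tile : ∀ p q i j → p < α → q < β → i < gv → j < gw →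
    at W (p * gv + i) (q * gw + j) ≡ at W i j
  tile p q i j p<α q<β i<gv j<gw = sym (begin
    at W i j                        ≡⟨ periodic-iterate (cols j j<w) p i row-bound ⟩
    at W (i + p * gv) j             ≡⟨ periodic-iterate (rows (i + p * gv) row-bound) q j col-bound ⟩
    at W (i + p * gv) (j + q * gw)  ≡⟨ cong₂ (at W) (+-comm i (p * gv)) (+-comm j (q * gw)) ⟩
    at W (p * gv + i) (q * gw + j)  ∎)
    where
    row-bound : i + p * gv < height W
    row-bound = subst₂ _<_ (+-comm (p * gv) i) (sym h≡) (block-bound p<α i<gv)
    col-bound : j + q * gw < width W
    col-bound = subst₂ _<_ (+-comm (q * gw) j) (sym w≡) (block-bound q<β j<gw)
    j<w : j < width W
    j<w = ≤-<-trans (m≤m+n j (q * gw)) col-bound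

-- A primitive array whose rows and columns have periods dividing its width and height
-- equals its top-left block of these sizes, so the periods are its dimensions.
primitive-periods : ∀ {S} (W : Array S) {gv gw} → 1 ≤ height W → 1 ≤ width W →
  gv ∣ height W → gw ∣ width W →
  (∀ i → i < height W → Periodic (at W i) (width W) gw) →
  (∀ j → j < width W → Periodic (λ i → at W i j) (height W) gv) →
  Primitive W → height W ≡ gv × width W ≡ gw
primitive-periods W 1≤h _ (divides zero h≡0) _ _ _ _ = ⊥-elim (<⇒≢ 1≤h (sym h≡0))
primitive-periods W _ 1≤w _ (divides zero w≡0) _ _ _ = ⊥-elim (<⇒≢ 1≤w (sym w≡0))
primitive-periods W {gv} {gw} _ _ (divides (suc α) h≡) (divides (suc β) w≡) rows cols prim
  with prim _ (suc α) (suc β) (s≤s z≤n) (s≤s z≤n) (periodic-power W rows cols h≡ w≡)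
... | refl , refl = trans h≡ (+-identityʳ gv) , trans w≡ (+-identityʳ gw)

gcd-fixed⇒∣ : ∀ {m n} → m ≡ gcd m n → m ∣ n
gcd-fixed⇒∣ {m} {n} m≡g = subst (_∣ n) (sym m≡g) (gcd[m,n]∣n m n)

dyadic-bound : ∀ a {x y} → 2 ^ a ≤ y → x < 2 ^ (a + 1) → x ≤ 2 * y
dyadic-bound a {x} le lt =
  <⇒≤ (<-≤-trans (subst (x <_) (cong (2 ^_) (+-comm a 1)) lt) (*-monoʳ-≤ 2 le))

dyadic-positive : ∀ a {x} → 2 ^ a ≤ x → 1 ≤ x
dyadic-positive a le = ≤-trans (m^n>0 2 a) le

primitive-divides : ∀ {S} (A W W' : Array S) (a b : ℕ) {r c r' c'} →
  IsABArray a b W → IsABArray a b W' → OccursCubeAt A W r c → OccursCubeAt A W' r' c' →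
  Aligned r (height W) r' (height W') → Aligned c (width W) c' (width W') →
  Primitive W → height W ∣ height W' × width W ∣ width W'
primitive-divides A W W' a b {r} {c} {r'} {c'} (h≥ , h< , w≥ , w<) (h'≥ , h'< , w'≥ , w'<)
                  occ occ' rows cols prim =
  gcd-fixed⇒∣ (proj₁ periods) , gcd-fixed⇒∣ (proj₂ periods)
  where
  instance
    nz-h : NonZero (height W)
    nz-h = >-nonZero (dyadic-positive a h≥)
    nz-w : NonZero (width W)
    nz-w = >-nonZero (dyadic-positive b w≥)
    nz-h' : NonZero (height W')
    nz-h' = >-nonZero (dyadic-positive a h'≥)
    nz-w' : NonZero (width W')
    nz-w' = >-nonZero (dyadic-positive b w'≥)
  K : Cube (at A) (at W) (height W) (width W) r c
  K = occurrence-cube occ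
  K' : Cube (at A) (at W') (height W') (width W') r' c'
  K' = occurrence-cube occ'
  R : Overlap r (height W) r' (height W')
  R = aligned-overlap (dyadic-bound a h'≥ h< , dyadic-bound a h≥ h'<) rows
  C : Overlap c (width W) c' (width W')
  C = aligned-overlap (dyadic-bound b w'≥ w< , dyadic-bound b w≥ w'<) cols
  periods : height W ≡ gcd (height W) (height W') × width W ≡ gcd (width W) (width W')
  periods = primitive-periods W (dyadic-positive a h≥) (dyadic-positive b w≥)
              (gcd[m,n]∣m _ _) (gcd[m,n]∣m _ _)
              (rows-periodic K K' R C) (columns-periodic K K' R C) prim

same-corner-equal : ∀ {S} {F V V' : ℕ → ℕ → S} {h w h' w' r c r' c'} →
  Cube F V h w r c → Cube F V' h' w' r' c' → h ≡ h' → w ≡ w' → r ≡ r' → c ≡ c' →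
  ∀ i j → i < h → j < w → V i j ≡ V' i j
same-corner-equal K K' refl refl refl refl i j i<h j<w =
  trans (sym (cube-origin K i j i<h j<w)) (cube-origin K' i j i<h j<w)

corollary13 : {S : Set} (A : Array S) (a b : ℕ) (W W' : Array S) →
    IsABArray a b W → IsABArray a b W' → ¬ (W ≈A W') →
    (r c r' c' : ℕ) → OccursCubeAt A W r c → OccursCubeAt A W' r' c' →
    ShareCorner W W' r c r' c' →
    ¬ (Primitive W × Primitive W')
corollary13 A a b W W' abW abW' W≉W' r c r' c' occ occ' corner (primW , primW') =
  W≉W' (h≡h' , w≡w' ,
        same-corner-equal (occurrence-cube {A = A} occ) (occurrence-cube {A = A} occ')
                          h≡h' w≡w' (aligned-equal rows h≡h') (aligned-equal cols w≡w'))
  where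
  rows : Aligned r (height W) r' (height W')
  rows = proj₁ (corner-alignment W W' corner)
  cols : Aligned c (width W) c' (width W')
  cols = proj₂ (corner-alignment W W' corner)
  W∣W' : height W ∣ height W' × width W ∣ width W'
  W∣W' = primitive-divides A W W' a b abW abW' occ occ' rows cols primW
  W'∣W : height W' ∣ height W × width W' ∣ width W
  W'∣W = primitive-divides A W' W a b abW' abW occ' occ (aligned-sym rows) (aligned-sym cols) primW'
  h≡h' : height W ≡ height W'
  h≡h' = ∣-antisym (proj₁ W∣W') (proj₁ W'∣W)
  w≡w' : width W ≡ width W'
  w≡w' = ∣-antisym (proj₂ W∣W') (proj₂ W'∣W)
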